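{- Let $A$ be a finite alphabet and let $F:A^{\mathbb N}\to A^{\mathbb N}$ be a dill map with diameter $\theta\geq 1$ and local rule $f:A^\theta\to A^+$. The following statements are equivalent: (1) $F$ induces a well-defined map on the Weyl space, i.e. for all $x,y\in A^{\mathbb N}$, $W_H(x,y)=0$ implies $W_H(F(x),F(y))=0$; (2) $F$ is $\frac{\theta\,\Delta_f}{\|f\|^- }$-Lipschitz with respect to $W_H$, i.e. $W_H(F(x),F(y))\le \frac{\theta\,\Delta_f}{\|f\|^- }\,W_H(x,y)$ for all $x,y\in A^{\mathbb N}$; (3) $F$ is either constant or uniform.
   Context: For a finite word $u=u_0u_1\cdots u_{|u|-1}$ and integers $a\le b$, write $u_{[a,b)}=u_a\cdots u_{b-1}$ (similarly for $x\in A^{\mathbb N}$). $A^+$ is the set of nonempty finite words. The Hamming distance of two words $u,v$ of the same length is $d_H(u,v)=|\{i: u_i\neq v_i\}|$. The Weyl pseudo-metric on $A^{\mathbb N}$ is $W_H(x,y)=\limsup_{\ell\to\infty}\max_{k\in\mathbb N}\frac{d_H(x_{[k,k+\ell)},y_{[k,k+\ell)})}{\ell}$. A map $F:A^{\mathbb N}\to A^{\mathbb N}$ is a dill map with diameter $\theta\in\mathbb N\setminus\{0\}$ and local rule $f:A^\theta\to A^+$ if $F(x)=f(x_{[0,\theta)})f(x_{[1,\theta+1)})f(x_{[2,\theta+2)})\cdots$ (infinite concatenation) for all $x$. Its lower norm is $\|f\|^-=\min\{|f(u)|:u\in A^\theta\}$ and upper norm $\|f\|^+=\max\{|f(u)|:u\in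 A^\theta\}$; $F$ is uniform if $\|f\|^-=\|f\|^+$. $\Delta_f=\max\{d_H(f(u),f(v)) : u,v\in A^\theta\}$ (the maximum being taken over pairs with $|f(u)|=|f(v)|$ when $F$ is not uniform). $F$ is constant if $F(x)=F(y)$ for all $x,y$. -}

module Defs where

open import Data.Nat as ℕ using (ℕ; zero; suc; _∸_; _⊓_; _⊔_; _≡ᵇ_)
open import Data.Fin using (Fin; toℕ; _≟_)
import Data.Fin as Fin
open import Data.List using (List; []; _∷_; length; map; concatMap; foldr; allFin)
open import Data.List.NonEmpty using (List⁺; toList; tail)
open import Data.Vec using (Vec; tabulate; replicate) renaming ([] to []ᵥ; _∷_ to _∷ᵥ_)
open import Data.Sum using (_⊎_; inj₁; inj₂)
open import Data.Product using (_×_; _,_; ∃; Σ)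
open import Data.Bool using (if_then_else_)
open import Data.Integer using (+_)
open import Data.Rational as ℚ using (ℚ; _/_; 0ℚ)
open import Relation.Nullary using (yes; no)
open import Relation.Binary.PropositionalEquality using (_≡_)

Seq : ℕ → Set
Seq k = ℕ → Fin (suc k)

LocalRule : ℕ → ℕ → Set
LocalRule k θ = Vec (Fin (suc k)) θ → List⁺ (Fin (suc k))

window : ∀ {k} θ → Seq k → ℕ → Vec (Fin (suc k)) θ
window θ x i = tabulate (λ j → x (i ℕ.+ toℕ j))

shift : ∀ {k} → Seq k → Seq k
shift x n = x (suc n)

step : ∀ {A : Set} → List A → ℕ → A ⊎ ℕ
step [] n = inj₂ n
step (a ∷ w) zero = inj₁ a
step (a ∷ w) (suc n) = step w n

-- n-th letter of f(x_{[0,θ)}) f(x_{[1,θ+1)}) ... ; fuel suc n suffices since blocks are nonempty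
dillAt : ∀ {k θ} → LocalRule k θ → ℕ → Seq k → ℕ → Fin (suc k)
dillAt f zero x n = Fin.zero
dillAt {θ = θ} f (suc fuel) x n with step (toList (f (window θ x 0))) n
... | inj₁ a = a
... | inj₂ m = dillAt f fuel (shift x) m

dill : ∀ {k θ} → LocalRule k θ → Seq k → Seq k
dill f x n = dillAt f (suc n) x n

allWords : ∀ k θ → List (Vec (Fin (suc k)) θ)
allWords k zero = []ᵥ ∷ []
allWords k (suc θ) = concatMap (λ a → map (a ∷ᵥ_) (allWords k θ)) (allFin (suc k))

len : ∀ {k θ} → LocalRule k θ → Vec (Fin (suc k)) θ → ℕ
len f u = length (toList (f u))

-- lower norm ‖f‖⁻ = min |f(u)|, written as suc (min (|f(u)| - 1))
lowerNorm : ∀ {k θ} → LocalRule k θ → ℕ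
lowerNorm {k} {θ} f =
  suc (foldr (λ u m → length (tail (f u)) ⊓ m)
             (length (tail (f (replicate θ Fin.zero)))) (allWords k θ))

-- Hamming distance of two lists (used only on equal-length lists)
hamL : ∀ {n} → List (Fin n) → List (Fin n) → ℕ
hamL [] _ = 0
hamL (_ ∷ _) [] = 0
hamL (a ∷ u) (b ∷ v) with a ≟ b
... | yes _ = hamL u v
... | no _ = suc (hamL u v)

Delta : ∀ {k θ} → LocalRule k θ → ℕ
Delta {k} {θ} f =
  foldr (λ u m → foldr (λ v m' →
           (if len f u ≡ᵇ len f v then hamL (toList (f u)) (toList (f v)) else 0) ⊔ m')
         m (allWords k θ))
        0 (allWords k θ)

hamWin : ∀ {k} → Seq k → Seq k → ℕ → ℕ → ℕ
hamWin x y i zero = 0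
hamWin x y i (suc ℓ) with x i ≟ y i
... | yes _ = hamWin x y (suc i) ℓ
... | no _ = suc (hamWin x y (suc i) ℓ)

-- W_H(x,y) ≤ q, i.e. limsup_ℓ max_i d_H(...)/ℓ ≤ q:
-- for every rational ε > 0 there is L with d_H(...)/ℓ ≤ q + ε for all ℓ ≥ L (ℓ ≥ 1) and all i.
WeylLe : ∀ {k} → Seq k → Seq k → ℚ → Set
WeylLe x y q =
  (ε : ℚ) → 0ℚ ℚ.< ε →
  ∃ λ L → (ℓ : ℕ) → L ℕ.≤ ℓ → (i : ℕ) →
    (+ (hamWin x y i (suc ℓ))) / (suc ℓ) ℚ.≤ q ℚ.+ ε

WeylZero : ∀ {k} → Seq k → Seq k → Set
WeylZero x y = WeylLe x y 0ℚ

IsUniform : ∀ {k θ} → LocalRule k θ → Set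
IsUniform f = ∀ u v → len f u ≡ len f v

IsConstant : ∀ {k} → (Seq k → Seq k) → Set
IsConstant F = ∀ x y n → F x n ≡ F y n

WeylWellDefined : ∀ {k} → (Seq k → Seq k) → Set
WeylWellDefined F = ∀ x y → WeylZero x y → WeylZero (F x) (F y)

WeylLipschitz : ∀ {k} → (Seq k → Seq k) → ℚ → Set
WeylLipschitz F c = ∀ x y q → WeylLe x y q → WeylLe (F x) (F y) (c ℚ.* q)

lipConst : ∀ {k θ} → LocalRule k θ → ℚ
lipConst {θ = θ} f = (+ (θ ℕ.* Delta f)) / lowerNorm f

{-# OPTIONS --safe #-}
module Submission where

open import Defs
open import Data.Nat as ℕ
  using (ℕ; zero; suc; _+_; _*_; _∸_; _≤_; _<_; z≤n; s≤s; _⊓_; _⊔_; _≡ᵇ_)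
import Data.Nat.Properties as ℕP
open import Algebra.Properties.CommutativeSemigroup ℕP.+-commutativeSemigroup
  using () renaming (x∙yz≈y∙xz to +-left-comm)
open import Data.Nat.DivMod using (_%_; [m+n]%n≡m%n; m<n⇒m%n≡m; m≡m%n+[m/n]*n; m%n<n; m/n*n≤m; m*n/n≡m; /-monoˡ-≤)
open import Data.Nat.Tactic.RingSolver using (solve-∀)
open import Data.Fin as Fin using (Fin; toℕ; _≟_)
import Data.Fin.Properties as FinP
open import Data.List using (List; []; _∷_; length; _++_; map; foldr)
import Data.List.Properties as ListP
open import Data.List.NonEmpty using (toList; tail)
open import Data.List.Membership.Propositional using (_∈_)
open import Data.List.Membership.Propositional.Properties using (∈-concatMap⁺; ∈-map⁺; ∈-allFin)
open import Data.List.Relation.Unary.Any as Any using (here; there)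
import Data.List.Relation.Unary.All as All
open import Data.Vec using (Vec; []; _∷_; replicate)
import Data.Vec.Properties as VecP
open import Data.Bool using (true; if_then_else_)
open import Data.Integer as ℤ using (+_; -[1+_])
import Data.Integer.Properties as ℤP
open import Data.Rational as ℚ using (ℚ; mkℚ; _/_; 0ℚ; 1ℚ; ½; toℚᵘ)
import Data.Rational.Properties as ℚP
import Data.Rational.Unnormalised as ℚᵘ
import Data.Rational.Unnormalised.Properties as ℚᵘP
open import Data.Rational.Solver using (module +-*-Solver)
open import Data.Product using (_×_; _,_; ∃; proj₁; proj₂)
open import Data.Sum using (_⊎_; inj₁; inj₂)
open import Data.Empty using (⊥-elim)
open import Function.Bundles using (_⇔_; mk⇔)
open import Relation.Nullary using (¬_; yes; no)
import Relation.Nullary.Decidable as Dec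
open import Relation.Nullary.Decidable using (Dec; decidable-stable)
open import Relation.Binary using (tri<; tri≈; tri>)
open import Relation.Binary.PropositionalEquality

-- (2) ⇒ (1) is the case W_H(x,y) = 0. For (3) ⇒ (2), a constant map is trivially Lipschitz; if every
-- block has length m, a window of length ℓ of F x meets at most ℓ/m + 2 consecutive blocks, a block
-- differs in at most Δ_f places and only if one of the θ letters it depends on differs, and double
-- counting these letters bounds the mismatches by Δ_f θ (W_H(x,y) + ε)(ℓ/m + 2).
-- For (1) ⇒ (3), suppose some x, y agreeing from K on have first K blocks of total lengths differing
-- by d > 0. Splicing x or y in front of a periodic z gives Weyl-equivalent sequences whose images are
-- F z preceded by words of lengths differing by d; a periodic sequence is Weyl-equivalent to a shift
-- of itself only if the shift fixes it, so F z is d-periodic. Images of periodic sequences are then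
-- determined by their first d + θ letters, which forces F z = F 0^ω for periodic z, and by locality
-- F is constant. If no such x, y exist, zeroing the letters of a window one at a time shows that all
-- blocks have the length of f(0^θ).

module _ {X : Set} where

  infixr 5 _++ˢ_

  _++ˢ_ : List X → (ℕ → X) → ℕ → X
  ([] ++ˢ s) i = s i
  ((a ∷ w) ++ˢ s) zero = a
  ((a ∷ w) ++ˢ s) (suc i) = (w ++ˢ s) i

  ++ˢ-length : ∀ w s i → (w ++ˢ s) (length w + i) ≡ s i
  ++ˢ-length [] s i = refl
  ++ˢ-length (a ∷ w) s i = ++ˢ-length w s i

  ++ˢ-< : ∀ w s t {i} → i < length w → (w ++ˢ s) i ≡ (w ++ˢ t) i
  ++ˢ-< (a ∷ w) s t {zero} _ = refl
  ++ˢ-< (a ∷ w) s t {suc i} (s≤s i<n) = ++ˢ-< w s t i<n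

  ++ˢ-assoc : ∀ v w s i → ((v ++ w) ++ˢ s) i ≡ (v ++ˢ (w ++ˢ s)) i
  ++ˢ-assoc [] w s i = refl
  ++ˢ-assoc (a ∷ v) w s zero = refl
  ++ˢ-assoc (a ∷ v) w s (suc i) = ++ˢ-assoc v w s i

  ++ˢ-cong : ∀ w {s t} → (∀ i → s i ≡ t i) → ∀ i → (w ++ˢ s) i ≡ (w ++ˢ t) i
  ++ˢ-cong [] s≗t i = s≗t i
  ++ˢ-cong (a ∷ w) s≗t zero = refl
  ++ˢ-cong (a ∷ w) s≗t (suc i) = ++ˢ-cong w s≗t i

  drop : ℕ → (ℕ → X) → ℕ → X
  drop n s i = s (n + i)

  splice : ℕ → (ℕ → X) → (ℕ → X) → ℕ → X
  splice K s t i with i ℕP.<? K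
  ... | yes _ = s i
  ... | no _ = t (i ∸ K)

  splice-< : ∀ K s t {i} → i < K → splice K s t i ≡ s i
  splice-< K s t {i} i<K with i ℕP.<? K
  ... | yes _ = refl
  ... | no i≮K = ⊥-elim (i≮K i<K)

  splice-≥ : ∀ K s t {i} → K ≤ i → splice K s t i ≡ t (i ∸ K)
  splice-≥ K s t {i} K≤i with i ℕP.<? K
  ... | yes i<K = ⊥-elim (ℕP.<⇒≱ i<K K≤i)
  ... | no _ = refl

  drop-splice : ∀ K s t i → drop K (splice K s t) i ≡ t i
  drop-splice K s t i = trans (splice-≥ K s t (ℕP.m≤m+n K i)) (cong t (ℕP.m+n∸m≡n K i))

  splice-cong-≥ : ∀ K′ {s t} u K → (∀ p → K ≤ p → s p ≡ t p) → ∀ p → K ≤ p → splice K′ s u p ≡ splice K′ t u p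
  splice-cong-≥ K′ u K s≡t p K≤p with p ℕP.<? K′
  ... | yes _ = s≡t p K≤p
  ... | no _ = refl

  Periodic : (ℕ → X) → ℕ → Set
  Periodic s d = ∀ i → s (d + i) ≡ s i

  periodic-* : ∀ {s d} → Periodic s d → ∀ c i → s (c * d + i) ≡ s i
  periodic-* per zero i = refl
  periodic-* {s} {d} per (suc c) i =
    trans (cong s (ℕP.+-assoc d (c * d) i)) (trans (per (c * d + i)) (periodic-* per c i))

  periodic-drop : ∀ {s d} → Periodic s d → ∀ n → Periodic (drop n s) d
  periodic-drop {s} {d} per n i = trans (cong s (+-left-comm n d i)) (per (n + i))


  periodic-agree-< : ∀ {s t d} → 1 ≤ d → Periodic s d → Periodic t d →
    (∀ i → i < d → s i ≡ t i) → ∀ i → s i ≡ t i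
  periodic-agree-< {s} {t} {d} 1≤d ps pt s≡t<d i = go (suc i) i (ℕP.n<1+n i)
    where
    go : ∀ n i → i < n → s i ≡ t i
    go (suc n) i (s≤s i≤n) with i ℕP.<? d
    ... | yes i<d = s≡t<d i i<d
    ... | no i≮d = begin
      s i             ≡⟨ cong s (sym d+j≡i) ⟩
      s (d + (i ∸ d)) ≡⟨ ps (i ∸ d) ⟩
      s (i ∸ d)       ≡⟨ go n (i ∸ d) (ℕP.≤-trans (ℕP.∸-monoʳ-< 1≤d (ℕP.≮⇒≥ i≮d)) i≤n) ⟩
      t (i ∸ d)       ≡⟨ pt (i ∸ d) ⟨
      t (d + (i ∸ d)) ≡⟨ cong t d+j≡i ⟩
      t i             ∎
      where
      open ≡-Reasoning
      d+j≡i = ℕP.m+[n∸m]≡n (ℕP.≮⇒≥ i≮d)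

  periodic-agree-tail : ∀ {s t d} → 1 ≤ d → Periodic s d → Periodic t d →
    ∀ T → (∀ i → s (T + i) ≡ t (T + i)) → ∀ i → s i ≡ t i
  periodic-agree-tail {s} {t} {d} 1≤d ps pt T tail≡ i = begin
    s i                     ≡⟨ periodic-* ps T i ⟨
    s (T * d + i)           ≡⟨ cong s T+j≡ ⟨
    s (T + (T * d ∸ T + i)) ≡⟨ tail≡ _ ⟩
    t (T + (T * d ∸ T + i)) ≡⟨ cong t T+j≡ ⟩
    t (T * d + i)           ≡⟨ periodic-* pt T i ⟩
    t i                     ∎
    where
    open ≡-Reasoning
    T+j≡ : T + (T * d ∸ T + i) ≡ T * d + i
    T+j≡ = trans (sym (ℕP.+-assoc T _ i)) (cong (_+ i) (ℕP.m+[n∸m]≡n (ℕP.m≤m*n T d {{ℕ.>-nonZero 1≤d}})))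

  periodise : (P : ℕ) .{{_ : ℕ.NonZero P}} → (ℕ → X) → ℕ → X
  periodise P s i = s (i % P)

  periodise-periodic : ∀ P .{{_ : ℕ.NonZero P}} s → Periodic (periodise P s) P
  periodise-periodic P s i = cong s (trans (cong (_% P) (ℕP.+-comm P i)) ([m+n]%n≡m%n i P))

  periodise-< : ∀ P .{{_ : ℕ.NonZero P}} s {i} → i < P → periodise P s i ≡ s i
  periodise-< P s i<P = cong s (m<n⇒m%n≡m i<P)

module _ {k : ℕ} where

  zeros : Seq k
  zeros _ = Fin.zero

  zeros-periodic : ∀ m → Periodic zeros m
  zeros-periodic m _ = refl

  zeroPrefix : ℕ → Seq k → Seq k
  zeroPrefix r x = splice r zeros (drop r x)

  zeroPrefix-≥ : ∀ r x {i} → r ≤ i → zeroPrefix r x i ≡ x i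
  zeroPrefix-≥ r x r≤i = trans (splice-≥ r zeros (drop r x) r≤i) (cong x (ℕP.m+[n∸m]≡n r≤i))

  zeroPrefix-cong : ∀ r {y z : Seq k} → (∀ i → r ≤ i → y i ≡ z i) → ∀ i → zeroPrefix r y i ≡ zeroPrefix r z i
  zeroPrefix-cong r y≈z i with i ℕP.<? r
  ... | yes _ = refl
  ... | no _ = y≈z (r + (i ∸ r)) (ℕP.m≤m+n r _)

  extend : ∀ {n} → Vec (Fin (suc k)) n → Seq k
  extend [] i = Fin.zero
  extend (a ∷ w) zero = a
  extend (a ∷ w) (suc i) = extend w i

  window-extend : ∀ {n} (w : Vec (Fin (suc k)) n) → window n (extend w) 0 ≡ w
  window-extend [] = refl
  window-extend (a ∷ w) = cong (a ∷_) (window-extend w)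

  extend-≥ : ∀ {n} (w : Vec (Fin (suc k)) n) {i} → n ≤ i → extend w i ≡ Fin.zero
  extend-≥ [] _ = refl
  extend-≥ (a ∷ w) {suc i} (s≤s n≤i) = extend-≥ w n≤i

sumFrom : (ℕ → ℕ) → ℕ → ℕ → ℕ
sumFrom h j zero = 0
sumFrom h j (suc n) = h j + sumFrom h (suc j) n

sumFrom-cong : ∀ {g h} → (∀ t → g t ≡ h t) → ∀ j n → sumFrom g j n ≡ sumFrom h j n
sumFrom-cong g≗h j zero = refl
sumFrom-cong g≗h j (suc n) = cong₂ _+_ (g≗h j) (sumFrom-cong g≗h (suc j) n)

sumFrom-zero : ∀ j n → sumFrom (λ _ → 0) j n ≡ 0
sumFrom-zero j zero = refl
sumFrom-zero j (suc n) = sumFrom-zero (suc j) n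

sumFrom-+ : ∀ g h j n → sumFrom (λ t → g t + h t) j n ≡ sumFrom g j n + sumFrom h j n
sumFrom-+ g h j zero = refl
sumFrom-+ g h j (suc n) = begin
  g j + h j + sumFrom (λ t → g t + h t) (suc j) n
    ≡⟨ cong (λ r → g j + h j + r) (sumFrom-+ g h (suc j) n) ⟩
  g j + h j + (sumFrom g (suc j) n + sumFrom h (suc j) n)
    ≡⟨ ℕP.+-assoc (g j) (h j) _ ⟩
  g j + (h j + (sumFrom g (suc j) n + sumFrom h (suc j) n))
    ≡⟨ cong (λ r → g j + r) (+-left-comm (h j) (sumFrom g (suc j) n) (sumFrom h (suc j) n)) ⟩
  g j + (sumFrom g (suc j) n + (h j + sumFrom h (suc j) n))
    ≡⟨ ℕP.+-assoc (g j) _ _ ⟨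
  g j + sumFrom g (suc j) n + (h j + sumFrom h (suc j) n) ∎
  where open ≡-Reasoning

sumFrom-suc : ∀ h j n → sumFrom (λ t → h (suc t)) j n ≡ sumFrom h (suc j) n
sumFrom-suc h j zero = refl
sumFrom-suc h j (suc n) = cong (λ r → h (suc j) + r) (sumFrom-suc h (suc j) n)

sumFrom-comm : ∀ (δ : ℕ → ℕ) j m n →
  sumFrom (λ s → sumFrom δ s n) j m ≡ sumFrom (λ t → sumFrom δ t m) j n
sumFrom-comm δ j zero n = sym (sumFrom-zero j n)
sumFrom-comm δ j (suc m) n = begin
  sumFrom δ j n + sumFrom (λ s → sumFrom δ s n) (suc j) m
    ≡⟨ cong (λ r → sumFrom δ j n + r) (sumFrom-comm δ (suc j) m n) ⟩
  sumFrom δ j n + sumFrom (λ t → sumFrom δ t m) (suc j) n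
    ≡⟨ cong (λ r → sumFrom δ j n + r) (sumFrom-suc (λ t → sumFrom δ t m) j n) ⟨
  sumFrom δ j n + sumFrom (λ t → sumFrom δ (suc t) m) j n
    ≡⟨ sumFrom-+ δ (λ t → sumFrom δ (suc t) m) j n ⟨
  sumFrom (λ t → δ t + sumFrom δ (suc t) m) j n ∎
  where open ≡-Reasoning

module _ {k : ℕ} where

  mismatch : Seq k → Seq k → ℕ → ℕ
  mismatch x y p with x p ≟ y p
  ... | yes _ = 0
  ... | no _ = 1

  hamWin-sumFrom : ∀ x y i ℓ → hamWin x y i ℓ ≡ sumFrom (mismatch x y) i ℓ
  hamWin-sumFrom x y i zero = refl
  hamWin-sumFrom x y i (suc ℓ) with x i ≟ y i
  ... | yes _ = hamWin-sumFrom x y (suc i) ℓ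
  ... | no _ = cong suc (hamWin-sumFrom x y (suc i) ℓ)

  -- double counting of the mismatches in the parallelogram {(s, s + c) : j ≤ s < j + m, c < n}
  sumFrom-hamWin-comm : ∀ x y j m n →
    sumFrom (λ s → hamWin x y s n) j m ≡ sumFrom (λ t → hamWin x y t m) j n
  sumFrom-hamWin-comm x y j m n = begin
    sumFrom (λ s → hamWin x y s n) j m
      ≡⟨ sumFrom-cong (λ s → hamWin-sumFrom x y s n) j m ⟩
    sumFrom (λ s → sumFrom (mismatch x y) s n) j m
      ≡⟨ sumFrom-comm (mismatch x y) j m n ⟩
    sumFrom (λ t → sumFrom (mismatch x y) t m) j n
      ≡⟨ sumFrom-cong (λ t → hamWin-sumFrom x y t m) j n ⟨
    sumFrom (λ t → hamWin x y t m) j n ∎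
    where open ≡-Reasoning

  hamWin-cong : ∀ {x x′ y y′ : Seq k} → (∀ p → x p ≡ x′ p) → (∀ p → y p ≡ y′ p) →
    ∀ i ℓ → hamWin x y i ℓ ≡ hamWin x′ y′ i ℓ
  hamWin-cong x≗x′ y≗y′ i zero = refl
  hamWin-cong {x} {x′} {y} {y′} x≗x′ y≗y′ i (suc ℓ) with x i ≟ y i | x′ i ≟ y′ i
  ... | yes _ | yes _ = hamWin-cong x≗x′ y≗y′ (suc i) ℓ
  ... | no _ | no _ = cong suc (hamWin-cong x≗x′ y≗y′ (suc i) ℓ)
  ... | yes e | no ne = ⊥-elim (ne (trans (sym (x≗x′ i)) (trans e (y≗y′ i))))
  ... | no ne | yes e = ⊥-elim (ne (trans (x≗x′ i) (trans e (sym (y≗y′ i)))))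

  hamWin-+ : ∀ (x y : Seq k) i a b → hamWin x y i (a + b) ≡ hamWin x y i a + hamWin x y (i + a) b
  hamWin-+ x y i zero b = cong (λ j → hamWin x y j b) (sym (ℕP.+-identityʳ i))
  hamWin-+ x y i (suc a) b with x i ≟ y i
  ... | yes _ = trans (hamWin-+ x y (suc i) a b) (cong (λ j → hamWin x y (suc i) a + hamWin x y j b) (sym (ℕP.+-suc i a)))
  ... | no _ = cong suc (trans (hamWin-+ x y (suc i) a b) (cong (λ j → hamWin x y (suc i) a + hamWin x y j b) (sym (ℕP.+-suc i a))))

  hamWin-drop : ∀ (x y : Seq k) a i ℓ → hamWin x y (a + i) ℓ ≡ hamWin (drop a x) (drop a y) i ℓ
  hamWin-drop x y a i zero = refl
  hamWin-drop x y a i (suc ℓ) with x (a + i) ≟ y (a + i)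
  ... | yes _ = trans (cong (λ j → hamWin x y j ℓ) (sym (ℕP.+-suc a i))) (hamWin-drop x y a (suc i) ℓ)
  ... | no _ = cong suc (trans (cong (λ j → hamWin x y j ℓ) (sym (ℕP.+-suc a i))) (hamWin-drop x y a (suc i) ℓ))

  hamWin-mono : ∀ (x y : Seq k) a r ℓ ℓ′ → r + ℓ ≤ ℓ′ → hamWin x y (a + r) ℓ ≤ hamWin x y a ℓ′
  hamWin-mono x y a r ℓ ℓ′ r+ℓ≤ℓ′ = begin
    hamWin x y (a + r) ℓ
      ≤⟨ ℕP.m≤m+n _ _ ⟩
    hamWin x y (a + r) ℓ + hamWin x y (a + r + ℓ) e
      ≡⟨ hamWin-+ x y (a + r) ℓ e ⟨
    hamWin x y (a + r) (ℓ + e)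
      ≤⟨ ℕP.m≤n+m _ _ ⟩
    hamWin x y a r + hamWin x y (a + r) (ℓ + e)
      ≡⟨ hamWin-+ x y a r (ℓ + e) ⟨
    hamWin x y a (r + (ℓ + e))
      ≡⟨ cong (hamWin x y a) (trans (sym (ℕP.+-assoc r ℓ e)) (ℕP.m+[n∸m]≡n r+ℓ≤ℓ′)) ⟩
    hamWin x y a ℓ′ ∎
    where
    open ℕP.≤-Reasoning
    e = ℓ′ ∸ (r + ℓ)

  hamWin-mismatch : ∀ (x y : Seq k) i ℓ → x i ≢ y i → 1 ≤ hamWin x y i (suc ℓ)
  hamWin-mismatch x y i ℓ x≢y with x i ≟ y i
  ... | yes x≡y = ⊥-elim (x≢y x≡y)
  ... | no _ = s≤s z≤n

  hamWin≡0⇒≡ : ∀ (x y : Seq k) i ℓ → hamWin x y i ℓ ≡ 0 → ∀ c → c < ℓ → x (i + c) ≡ y (i + c)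
  hamWin≡0⇒≡ x y i (suc ℓ) h≡0 c c<ℓ with x i ≟ y i
  hamWin≡0⇒≡ x y i (suc ℓ) h≡0 zero c<ℓ | yes x≡y = subst (λ j → x j ≡ y j) (sym (ℕP.+-identityʳ i)) x≡y
  hamWin≡0⇒≡ x y i (suc ℓ) h≡0 (suc c) (s≤s c<ℓ) | yes _ =
    subst (λ j → x j ≡ y j) (sym (ℕP.+-suc i c)) (hamWin≡0⇒≡ x y (suc i) ℓ h≡0 c c<ℓ)

  hamWin-≤-∸ : ∀ (x y : Seq k) K → (∀ p → K ≤ p → x p ≡ y p) → ∀ i ℓ → hamWin x y i ℓ ≤ K ∸ i
  hamWin-≤-∸ x y K agree i zero = z≤n
  hamWin-≤-∸ x y K agree i (suc ℓ) with x i ≟ y i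
  ... | yes _ = ℕP.≤-trans (hamWin-≤-∸ x y K agree (suc i) ℓ) (ℕP.∸-monoʳ-≤ K (ℕP.n≤1+n i))
  ... | no x≢y with i ℕP.<? K
  ...   | yes i<K = ℕP.≤-trans (s≤s (hamWin-≤-∸ x y K agree (suc i) ℓ)) (ℕP.≤-reflexive (sym (ℕP.+-∸-assoc 1 i<K)))
  ...   | no i≮K = ⊥-elim (x≢y (agree i (ℕP.≮⇒≥ i≮K)))

fromℕ : ℕ → ℚ
fromℕ n = + n / 1

-- ℚ's _/_ normalises by a gcd, so identities about fractions are proved in ℚᵘ
toℚᵘ-/ : ∀ a b → toℚᵘ ((+ a) / suc b) ℚᵘ.≃ ℚᵘ.mkℚᵘ (+ a) b
toℚᵘ-/ a b = ℚP.toℚᵘ-fromℚᵘ (ℚᵘ.mkℚᵘ (+ a) b)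

*-≤⇒/-≤ : ∀ a b c d → a * suc d ≤ c * suc b → (+ a) / suc b ℚ.≤ (+ c) / suc d
*-≤⇒/-≤ a b c d ad≤cb = ℚP.toℚᵘ-cancel-≤
  (ℚᵘP.≤-respʳ-≃ (ℚᵘP.≃-sym (toℚᵘ-/ c d)) (ℚᵘP.≤-respˡ-≃ (ℚᵘP.≃-sym (toℚᵘ-/ a b))
    (ℚᵘ.*≤* (subst₂ ℤ._≤_ (ℤP.pos-* a (suc d)) (ℤP.pos-* c (suc b)) (ℤ.+≤+ ad≤cb)))))

/-≤⇒*-≤ : ∀ a b c d → (+ a) / suc b ℚ.≤ (+ c) / suc d → a * suc d ≤ c * suc b
/-≤⇒*-≤ a b c d a/b≤c/d = ℤP.drop‿+≤+ (subst₂ ℤ._≤_ (sym (ℤP.pos-* a (suc d))) (sym (ℤP.pos-* c (suc b)))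
  (ℚᵘP.drop-*≤* (ℚᵘP.≤-respʳ-≃ (toℚᵘ-/ c d) (ℚᵘP.≤-respˡ-≃ (toℚᵘ-/ a b) (ℚP.toℚᵘ-mono-≤ a/b≤c/d)))))

/-pos : ∀ a b → 0ℚ ℚ.< (+ suc a) / suc b
/-pos a b = ℚP.toℚᵘ-cancel-<
  (ℚᵘP.<-respʳ-≃ (ℚᵘP.≃-sym (toℚᵘ-/ (suc a) b)) (ℚᵘ.*<* (ℤ.+<+ (s≤s z≤n))))

private
  toℚᵘ-injective′ : ∀ {p q u} → toℚᵘ p ℚᵘ.≃ u → toℚᵘ q ℚᵘ.≃ u → p ≡ q
  toℚᵘ-injective′ p≃u q≃u = ℚP.toℚᵘ-injective (ℚᵘP.≃-trans p≃u (ℚᵘP.≃-sym q≃u))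

  mkℚᵘ-cong : ∀ {i j d} → i ≡ j → ℚᵘ.mkℚᵘ i d ℚᵘ.≃ ℚᵘ.mkℚᵘ j d
  mkℚᵘ-cong refl = ℚᵘP.≃-refl

fromℕ-+ : ∀ a b → fromℕ (a + b) ≡ fromℕ a ℚ.+ fromℕ b
fromℕ-+ a b = toℚᵘ-injective′
  (ℚᵘP.≃-trans (toℚᵘ-/ (a + b) 0) (mkℚᵘ-cong (trans (ℤP.pos-+ a b)
    (sym (cong₂ ℤ._+_ (ℤP.*-identityʳ (+ a)) (ℤP.*-identityʳ (+ b)))))))
  (ℚᵘP.≃-trans (ℚP.toℚᵘ-homo-+ (fromℕ a) (fromℕ b)) (ℚᵘP.+-cong (toℚᵘ-/ a 0) (toℚᵘ-/ b 0)))

fromℕ-* : ∀ a b → fromℕ (a * b) ≡ fromℕ a ℚ.* fromℕ b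
fromℕ-* a b = toℚᵘ-injective′
  (ℚᵘP.≃-trans (toℚᵘ-/ (a * b) 0) (mkℚᵘ-cong (ℤP.pos-* a b)))
  (ℚᵘP.≃-trans (ℚP.toℚᵘ-homo-* (fromℕ a) (fromℕ b)) (ℚᵘP.*-cong (toℚᵘ-/ a 0) (toℚᵘ-/ b 0)))

fromℕ-mono-≤ : ∀ {a b} → a ≤ b → fromℕ a ℚ.≤ fromℕ b
fromℕ-mono-≤ {a} {b} a≤b = *-≤⇒/-≤ a 0 b 0 (ℕP.*-monoˡ-≤ 1 a≤b)

fromℕ-nonNeg : ∀ a → 0ℚ ℚ.≤ fromℕ a
fromℕ-nonNeg a = fromℕ-mono-≤ {0} {a} z≤n

fromℕ-*-1/ : ∀ a b → fromℕ a ℚ.* ((+ 1) / suc b) ≡ (+ a) / suc b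
fromℕ-*-1/ a b = toℚᵘ-injective′
  (ℚᵘP.≃-trans (ℚP.toℚᵘ-homo-* (fromℕ a) ((+ 1) / suc b))
    (ℚᵘP.≃-trans (ℚᵘP.*-cong (toℚᵘ-/ a 0) (toℚᵘ-/ 1 b)) (ℚᵘ.*≡* (cong₂ ℤ._*_ (ℤP.*-identityʳ (+ a)) (cong (λ n → + suc n) (sym (ℕP.+-identityʳ b)))))))
  (toℚᵘ-/ a b)

/-*-fromℕ : ∀ a b → ((+ a) / suc b) ℚ.* fromℕ (suc b) ≡ fromℕ a
/-*-fromℕ a b = toℚᵘ-injective′
  (ℚᵘP.≃-trans (ℚP.toℚᵘ-homo-* ((+ a) / suc b) (fromℕ (suc b)))
    (ℚᵘP.≃-trans (ℚᵘP.*-cong (toℚᵘ-/ a b) (toℚᵘ-/ (suc b) 0)) (ℚᵘ.*≡* (trans (ℤP.*-identityʳ _) (cong (λ n → + a ℤ.* + suc n) (sym (ℕP.*-identityʳ b)))))))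
  (toℚᵘ-/ a 0)

/-self : ∀ b → (+ suc b) / suc b ≡ 1ℚ
/-self b = toℚᵘ-injective′
  (ℚᵘP.≃-trans (toℚᵘ-/ (suc b) b) (ℚᵘ.*≡* (trans (ℤP.*-identityʳ (+ suc b)) (sym (ℤP.*-identityˡ (+ suc b))))))
  (toℚᵘ-/ 1 0)

/-≤⇒≤-*-fromℕ : ∀ h b r → (+ h) / suc b ℚ.≤ r → fromℕ h ℚ.≤ r ℚ.* fromℕ (suc b)
/-≤⇒≤-*-fromℕ h b r h/b≤r = subst (ℚ._≤ r ℚ.* fromℕ (suc b)) (/-*-fromℕ h b)
  (ℚP.*-monoʳ-≤-nonNeg (fromℕ (suc b)) {{ℚ.nonNegative (fromℕ-nonNeg (suc b))}} h/b≤r)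

≤-*-fromℕ⇒/-≤ : ∀ h b r → fromℕ h ℚ.≤ r ℚ.* fromℕ (suc b) → (+ h) / suc b ℚ.≤ r
≤-*-fromℕ⇒/-≤ h b r h≤rb = subst₂ ℚ._≤_ (fromℕ-*-1/ h b) r*b/b≡r
  (ℚP.*-monoʳ-≤-nonNeg ((+ 1) / suc b) {{ℚ.nonNegative (*-≤⇒/-≤ 0 0 1 b z≤n)}} h≤rb)
  where
  r*b/b≡r : r ℚ.* fromℕ (suc b) ℚ.* ((+ 1) / suc b) ≡ r
  r*b/b≡r = trans (ℚP.*-assoc r (fromℕ (suc b)) _)
    (trans (cong (r ℚ.*_) (trans (fromℕ-*-1/ (suc b) b) (/-self b))) (ℚP.*-identityʳ r))

fromℕ-unbounded : ∀ r → ∃ λ n → r ℚ.≤ fromℕ n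
fromℕ-unbounded r@(mkℚ (+ n) d _) = n , ℚP.toℚᵘ-cancel-≤
  (ℚᵘP.≤-respʳ-≃ (ℚᵘP.≃-sym (toℚᵘ-/ n 0))
    (ℚᵘ.*≤* (subst₂ ℤ._≤_ (sym (ℤP.*-identityʳ (+ n))) (ℤP.pos-* n (suc d)) (ℤ.+≤+ (ℕP.m≤m*n n (suc d))))))
fromℕ-unbounded r@(mkℚ -[1+ n ] d _) = 0 , ℚP.toℚᵘ-cancel-≤ (ℚᵘ.*≤* ℤ.-≤+)

archimedean : ∀ C ε → 0ℚ ℚ.< ε → ∃ λ L → ∀ n → L ≤ n → C ℚ.≤ ε ℚ.* fromℕ n
archimedean C (mkℚ (+ zero) _ _) (ℚ.*<* (ℤ.+<+ ()))
archimedean C (mkℚ -[1+ _ ] _ _) (ℚ.*<* ())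
archimedean C ε@(mkℚ (+ suc a) b _) _ = n₀ * suc b , λ n L≤n → begin
  C                           ≤⟨ C≤n₀ ⟩
  fromℕ n₀                    ≤⟨ *-≤⇒/-≤ n₀ 0 n b (ℕP.≤-trans L≤n (ℕP.≤-reflexive (sym (ℕP.*-identityʳ n)))) ⟩
  (+ n) / suc b               ≡⟨ fromℕ-*-1/ n b ⟨
  fromℕ n ℚ.* ((+ 1) / suc b) ≤⟨ ℚP.*-monoˡ-≤-nonNeg (fromℕ n) {{ℚ.nonNegative (fromℕ-nonNeg n)}} 1/b≤ε ⟩
  fromℕ n ℚ.* ε               ≡⟨ ℚP.*-comm (fromℕ n) ε ⟩
  ε ℚ.* fromℕ n               ∎
  where
  open ℚP.≤-Reasoning
  n₀ = proj₁ (fromℕ-unbounded C)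
  C≤n₀ = proj₂ (fromℕ-unbounded C)
  1/b≤ε : (+ 1) / suc b ℚ.≤ ε
  1/b≤ε = subst ((+ 1) / suc b ℚ.≤_) (ℚP.↥p/↧p≡p ε) (*-≤⇒/-≤ 1 b (suc a) b (ℕP.*-monoˡ-≤ (suc b) {1} {suc a} (s≤s z≤n)))

fromℕ-sumFrom-≤ : ∀ (h : ℕ → ℕ) X j n → (∀ t → fromℕ (h t) ℚ.≤ X) → fromℕ (sumFrom h j n) ℚ.≤ fromℕ n ℚ.* X
fromℕ-sumFrom-≤ h X j zero _ = ℚP.≤-reflexive (sym (ℚP.*-zeroˡ X))
fromℕ-sumFrom-≤ h X j (suc n) h≤X = begin
  fromℕ (h j + sumFrom h (suc j) n)           ≡⟨ fromℕ-+ (h j) _ ⟩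
  fromℕ (h j) ℚ.+ fromℕ (sumFrom h (suc j) n) ≤⟨ ℚP.+-mono-≤ (h≤X j) (fromℕ-sumFrom-≤ h X (suc j) n h≤X) ⟩
  X ℚ.+ fromℕ n ℚ.* X                         ≡⟨ solve 2 (λ X n → X :+ n :* X := (con 1ℚ :+ n) :* X) refl X (fromℕ n) ⟩
  (1ℚ ℚ.+ fromℕ n) ℚ.* X                      ≡⟨ cong (ℚ._* X) (fromℕ-+ 1 n) ⟨
  fromℕ (suc n) ℚ.* X                         ∎
  where
  open ℚP.≤-Reasoning
  open +-*-Solver

-- The Weyl pseudo-metric

module _ {k : ℕ} where

  weylZero-cong : ∀ {x x′ y y′ : Seq k} → (∀ p → x p ≡ x′ p) → (∀ p → y p ≡ y′ p) →
    WeylZero x y → WeylZero x′ y′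
  weylZero-cong x≗x′ y≗y′ x~y ε ε>0 with x~y ε ε>0
  ... | L , bound = L , λ ℓ L≤ℓ i →
    subst (λ h → (+ h) / suc ℓ ℚ.≤ _) (hamWin-cong x≗x′ y≗y′ i (suc ℓ)) (bound ℓ L≤ℓ i)

  -- if q < 0, then taking ε = -q/2 would bound a nonnegative ratio by q/2 < 0
  weylLe-nonNeg : ∀ {x y : Seq k} {q} → WeylLe x y q → 0ℚ ℚ.≤ q
  weylLe-nonNeg {x} {y} {q} x~y with 0ℚ ℚP.≤? q
  ... | yes 0≤q = 0≤q
  ... | no 0≰q = ⊥-elim (ℚP.<-irrefl refl (ℚP.≤-<-trans 0≤q/2 q/2<0))
    where
    q<0 = ℚP.≰⇒> 0≰q
    ε = ½ ℚ.* ℚ.- q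
    ε>0 : 0ℚ ℚ.< ε
    ε>0 = ℚP.*-monoʳ-<-pos ½ {{_}} (ℚP.neg-antimono-< q<0)
    q/2≡ : q ℚ.+ ε ≡ ½ ℚ.* q
    q/2≡ = solve 1 (λ q → q :+ con ½ :* (:- q) := con ½ :* q) refl q
      where open +-*-Solver
    0≤q/2 : 0ℚ ℚ.≤ ½ ℚ.* q
    0≤q/2 with x~y ε ε>0
    ... | L , bound = subst (0ℚ ℚ.≤_) q/2≡
      (ℚP.≤-trans (*-≤⇒/-≤ 0 0 (hamWin x y 0 (suc L)) L z≤n) (bound L ℕP.≤-refl 0))
    q/2<0 : ½ ℚ.* q ℚ.< 0ℚ
    q/2<0 = ℚP.*-monoʳ-<-pos ½ {{_}} q<0

  finiteDifference⇒weylZero : ∀ (x y : Seq k) K → (∀ p → K ≤ p → x p ≡ y p) → WeylZero x y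
  finiteDifference⇒weylZero x y K agree ε ε>0 with archimedean (fromℕ K) ε ε>0
  ... | L , K≤εn = L , λ ℓ L≤ℓ i → subst ((+ hamWin x y i (suc ℓ)) / suc ℓ ℚ.≤_) (sym (ℚP.+-identityˡ ε))
    (≤-*-fromℕ⇒/-≤ (hamWin x y i (suc ℓ)) ℓ ε (ℚP.≤-trans
      (fromℕ-mono-≤ (ℕP.≤-trans (hamWin-≤-∸ x y K agree i (suc ℓ)) (ℕP.m∸n≤m K i)))
      (K≤εn (suc ℓ) (ℕP.≤-trans L≤ℓ (ℕP.n≤1+n ℓ)))))

  hamWin-≥-periodicMismatch : ∀ (x y : Seq k) m j →
    (∀ c → x (j + c * suc m) ≢ y (j + c * suc m)) → ∀ c → c ≤ hamWin x y j (c * suc m)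
  hamWin-≥-periodicMismatch x y m j mismatchAt zero = z≤n
  hamWin-≥-periodicMismatch x y m j mismatchAt (suc c) rewrite hamWin-+ x y j (suc m) (c * suc m) =
    ℕP.+-mono-≤ (hamWin-mismatch x y j m (λ eq → mismatchAt 0 (subst (λ p → x p ≡ y p) (sym (ℕP.+-identityʳ j)) eq)))
      (hamWin-≥-periodicMismatch x y m (j + suc m)
        (λ c eq → mismatchAt (suc c) (subst (λ p → x p ≡ y p) (ℕP.+-assoc j (suc m) (c * suc m)) eq)) c)

  -- a window of length (L+1)(m+1) contains at least L+1 mismatches, a density above 1/(m+2)
  periodicMismatch⇒¬weylZero : ∀ (x y : Seq k) m j →
    (∀ c → x (j + c * suc m) ≢ y (j + c * suc m)) → ¬ WeylZero x y
  periodicMismatch⇒¬weylZero x y m j mismatchAt x~y with x~y ((+ 1) / suc (suc m)) (/-pos 0 (suc m))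
  ... | L , bound = ℕP.<-irrefl refl (ℕP.<-≤-trans (ℕP.m<n+m (suc ℓ) (s≤s z≤n)) (begin
      suc L + suc ℓ              ≡⟨ ℕP.*-suc (suc L) (suc m) ⟨
      suc L * suc (suc m)        ≤⟨ ℕP.*-monoˡ-≤ (suc (suc m)) (hamWin-≥-periodicMismatch x y m j mismatchAt (suc L)) ⟩
      h * suc (suc m)            ≤⟨ /-≤⇒*-≤ h ℓ 1 (suc m) h/ℓ≤ ⟩
      1 * suc ℓ                  ≡⟨ ℕP.*-identityˡ (suc ℓ) ⟩
      suc ℓ                      ∎))
    where
    open ℕP.≤-Reasoning
    ℓ = m + L * suc m
    h = hamWin x y j (suc ℓ)
    h/ℓ≤ : (+ h) / suc ℓ ℚ.≤ (+ 1) / suc (suc m)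
    h/ℓ≤ = subst ((+ h) / suc ℓ ℚ.≤_) (ℚP.+-identityˡ _)
      (bound ℓ (ℕP.≤-trans (ℕP.m≤m*n L (suc m)) (ℕP.m≤n+m (L * suc m) m)) j)

  weylZero-++ˢ-periodic : ∀ {P : Seq k} {m} → 1 ≤ m → Periodic P m →
    ∀ u v → WeylZero (u ++ˢ P) (v ++ˢ P) → ∀ i → P (length v + i) ≡ P (length u + i)
  weylZero-++ˢ-periodic {P} {suc m} _ per u v u~v i with P (length v + i) ≟ P (length u + i)
  ... | yes eq = eq
  ... | no neq = ⊥-elim (periodicMismatch⇒¬weylZero (u ++ˢ P) (v ++ˢ P) m (length u + (length v + i)) mismatchAt u~v)
    where
    a = length u
    b = length v
    mismatchAt : ∀ c → (u ++ˢ P) (a + (b + i) + c * suc m) ≢ (v ++ˢ P) (a + (b + i) + c * suc m)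
    mismatchAt c eq = neq (begin
      P (b + i)                           ≡⟨ periodic-* per c (b + i) ⟨
      P (c * suc m + (b + i))             ≡⟨ cong P (ℕP.+-comm (c * suc m) (b + i)) ⟩
      P (b + i + c * suc m)               ≡⟨ ++ˢ-length u P _ ⟨
      (u ++ˢ P) (a + (b + i + c * suc m)) ≡⟨ cong (u ++ˢ P) (ℕP.+-assoc a (b + i) _) ⟨
      (u ++ˢ P) (a + (b + i) + c * suc m) ≡⟨ eq ⟩
      (v ++ˢ P) (a + (b + i) + c * suc m) ≡⟨ cong (v ++ˢ P) (ar a b i (c * suc m)) ⟩
      (v ++ˢ P) (b + (a + i + c * suc m)) ≡⟨ ++ˢ-length v P _ ⟩
      P (a + i + c * suc m)               ≡⟨ cong P (ℕP.+-comm (a + i) (c * suc m)) ⟩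
      P (c * suc m + (a + i))             ≡⟨ periodic-* per c (a + i) ⟩
      P (a + i)                           ∎)
      where
      open ≡-Reasoning
      ar : ∀ a b i n → a + (b + i) + n ≡ b + (a + i + n)
      ar = solve-∀

-- Dill maps

allWords-complete : ∀ k θ (w : Vec (Fin (suc k)) θ) → w ∈ allWords k θ
allWords-complete k zero [] = here refl
allWords-complete k (suc θ) (a ∷ w) =
  ∈-concatMap⁺ (λ b → map (b ∷_) (allWords k θ)) (Any.map (λ { refl → ∈-map⁺ (a ∷_) (allWords-complete k θ w) }) (∈-allFin a))

module Dill {k θ : ℕ} (f : LocalRule k θ) where

  firstBlock : Seq k → List (Fin (suc k))
  firstBlock x = toList (f (window θ x 0))

  blocks : Seq k → ℕ → List (Fin (suc k))
  blocks x zero = []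
  blocks x (suc K) = firstBlock x ++ blocks (shift x) K

  window-cong : ∀ (x y : Seq k) → (∀ i → x i ≡ y i) → window θ x 0 ≡ window θ y 0
  window-cong x y x≗y = VecP.tabulate-cong (λ j → x≗y (toℕ j))

  private
    step-inj₁ : ∀ (w : List (Fin (suc k))) s {n a} → step w n ≡ inj₁ a → (w ++ˢ s) n ≡ a
    step-inj₁ (b ∷ w) s {zero} refl = refl
    step-inj₁ (b ∷ w) s {suc n} eq = step-inj₁ w s eq

    step-inj₂ : ∀ (w : List (Fin (suc k))) {n m} → step w n ≡ inj₂ m → n ≡ length w + m
    step-inj₂ [] refl = refl
    step-inj₂ (b ∷ w) {suc n} eq = cong suc (step-inj₂ w eq)

    step-inj₂-< : ∀ x {n m} → step (firstBlock x) n ≡ inj₂ m → m < n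
    step-inj₂-< x {m = m} eq = subst (m <_) (sym (step-inj₂ (firstBlock x) eq)) (ℕP.+-monoˡ-≤ m (s≤s z≤n))

    dillAt-fuel : ∀ fuel fuel′ x {n} → n < fuel → n < fuel′ → dillAt f fuel x n ≡ dillAt f fuel′ x n
    dillAt-fuel (suc fuel) (suc fuel′) x {n} (s≤s n≤fuel) (s≤s n≤fuel′) with step (firstBlock x) n in eq
    ... | inj₁ a = refl
    ... | inj₂ m = dillAt-fuel fuel fuel′ (shift x)
      (ℕP.<-≤-trans (step-inj₂-< x eq) n≤fuel) (ℕP.<-≤-trans (step-inj₂-< x eq) n≤fuel′)

    dillAt-ext : ∀ fuel (x y : Seq k) → (∀ i → x i ≡ y i) → ∀ n → dillAt f fuel x n ≡ dillAt f fuel y n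
    dillAt-ext zero x y x≗y n = refl
    dillAt-ext (suc fuel) x y x≗y n
      with window θ x 0 | window θ y 0 | window-cong x y x≗y
    ... | w | .w | refl with step (toList (f w)) n
    ... | inj₁ a = refl
    ... | inj₂ m = dillAt-ext fuel (shift x) (shift y) (λ i → x≗y (suc i)) m

  dill-unfold : ∀ x n → dill f x n ≡ (firstBlock x ++ˢ dill f (shift x)) n
  dill-unfold x n with step (firstBlock x) n in eq
  ... | inj₁ a = sym (step-inj₁ (firstBlock x) (dill f (shift x)) {n} eq)
  ... | inj₂ m = begin
    dillAt f n (shift x) m
      ≡⟨ dillAt-fuel n (suc m) (shift x) (step-inj₂-< x eq) (ℕP.n<1+n m) ⟩
    dill f (shift x) m
      ≡⟨ ++ˢ-length (firstBlock x) _ m ⟨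
    (firstBlock x ++ˢ dill f (shift x)) (length (firstBlock x) + m)
      ≡⟨ cong (firstBlock x ++ˢ dill f (shift x)) (step-inj₂ (firstBlock x) {n} eq) ⟨
    (firstBlock x ++ˢ dill f (shift x)) n ∎
    where open ≡-Reasoning

  dill-ext : ∀ (x y : Seq k) → (∀ i → x i ≡ y i) → ∀ n → dill f x n ≡ dill f y n
  dill-ext x y x≗y n = dillAt-ext (suc n) x y x≗y n

  dill-blocks : ∀ K x n → dill f x n ≡ (blocks x K ++ˢ dill f (drop K x)) n
  dill-blocks zero x n = refl
  dill-blocks (suc K) x n = begin
    dill f x n
      ≡⟨ dill-unfold x n ⟩
    (firstBlock x ++ˢ dill f (shift x)) n
      ≡⟨ ++ˢ-cong (firstBlock x) (dill-blocks K (shift x)) n ⟩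
    (firstBlock x ++ˢ (blocks (shift x) K ++ˢ dill f (drop (suc K) x))) n
      ≡⟨ ++ˢ-assoc (firstBlock x) (blocks (shift x) K) _ n ⟨
    (blocks x (suc K) ++ˢ dill f (drop (suc K) x)) n ∎
    where open ≡-Reasoning

  dill-drop : ∀ K x i → dill f x (length (blocks x K) + i) ≡ dill f (drop K x) i
  dill-drop K x i = trans (dill-blocks K x _) (++ˢ-length (blocks x K) _ i)

  blocks-length-≥ : ∀ K x → K ≤ length (blocks x K)
  blocks-length-≥ zero x = z≤n
  blocks-length-≥ (suc K) x rewrite ListP.length-++ (firstBlock x) {blocks (shift x) K} =
    ℕP.+-mono-≤ (s≤s z≤n) (blocks-length-≥ K (shift x))

  blocks-++ : ∀ a b x → blocks x (a + b) ≡ blocks x a ++ blocks (drop a x) b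
  blocks-++ zero b x = refl
  blocks-++ (suc a) b x = trans (cong (firstBlock x ++_) (blocks-++ a b (shift x))) (sym (ListP.++-assoc (firstBlock x) _ _))

  firstBlock-local : ∀ (x y : Seq k) → (∀ i → i < θ → x i ≡ y i) → firstBlock x ≡ firstBlock y
  firstBlock-local x y x≡y = cong (λ w → toList (f w)) (VecP.tabulate-cong (λ j → x≡y (toℕ j) (FinP.toℕ<n j)))

  blocks-local : ∀ K (x y : Seq k) → (∀ i → suc i < K + θ → x i ≡ y i) → blocks x K ≡ blocks y K
  blocks-local zero x y x≡y = refl
  blocks-local (suc K) x y x≡y = cong₂ _++_
    (firstBlock-local x y (λ i i<θ → x≡y i (s≤s (ℕP.<-≤-trans i<θ (ℕP.m≤n+m θ K)))))
    (blocks-local K (shift x) (shift y) (λ i i<K+θ → x≡y (suc i) (s≤s i<K+θ)))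

  dill-local : ∀ n (x y : Seq k) → (∀ i → suc i < n + θ → x i ≡ y i) → ∀ {i} → i < n → dill f x i ≡ dill f y i
  dill-local n x y x≡y {i} i<n = begin
    dill f x i                               ≡⟨ dill-blocks n x i ⟩
    (blocks x n ++ˢ dill f (drop n x)) i     ≡⟨ cong (λ w → (w ++ˢ dill f (drop n x)) i) (blocks-local n x y x≡y) ⟩
    (blocks y n ++ˢ dill f (drop n x)) i     ≡⟨ ++ˢ-< (blocks y n) _ _ (ℕP.<-≤-trans i<n (blocks-length-≥ n y)) ⟩
    (blocks y n ++ˢ dill f (drop n y)) i     ≡⟨ dill-blocks n y i ⟨
    dill f y i                               ∎
    where open ≡-Reasoning

  dill-periodic : ∀ {z m} → Periodic z m → Periodic (dill f z) (length (blocks z m))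
  dill-periodic {z} {m} per i = trans (dill-drop m z i) (dill-ext (drop m z) z per i)

  dill-splice : ∀ K s z n → dill f (splice K s z) n ≡ (blocks (splice K s z) K ++ˢ dill f z) n
  dill-splice K s z n = trans (dill-blocks K _ n) (++ˢ-cong (blocks _ K) (dill-ext _ z (drop-splice K s z)) n)

  length-blocks-splice : ∀ K s z → length (blocks (splice (K + θ) s z) (K + θ))
    ≡ length (blocks s K) + length (blocks (drop K (splice (K + θ) s z)) θ)
  length-blocks-splice K s z = trans (cong length (blocks-++ K θ _)) (trans (ListP.length-++ (blocks _ K))
    (cong (λ w → length w + length (blocks (drop K (splice (K + θ) s z)) θ)) (blocks-local K _ s (λ i si<K+θ → splice-< (K + θ) s z (ℕP.<-trans (ℕP.n<1+n i) si<K+θ)))))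

-- Well-defined on the Weyl space ⇒ constant or uniform

module _ {k θ : ℕ} (f : LocalRule k θ) where
  open Dill f

  record LengthDefect : Set where
    field
      K : ℕ
      s t : Seq k
      agree : ∀ p → K ≤ p → s p ≡ t p
      shorter : length (blocks s K) < length (blocks t K)

  module _ (wd : WeylWellDefined (dill f)) where

    dill-zeros-periodic-splice : ∀ K s → Periodic (dill f zeros) (length (blocks (splice K s zeros) K))
    dill-zeros-periodic-splice K s i = begin
      dill f zeros (length (blocks (splice K s zeros) K) + i) ≡⟨ shifted i ⟨
      dill f zeros (length (blocks zeros K) + i)               ≡⟨ dill-periodic {zeros} {K} (zeros-periodic K) i ⟩
      dill f zeros i                                          ∎
      where
      open ≡-Reasoning
      shifted = weylZero-++ˢ-periodic (s≤s z≤n) (dill-periodic {zeros} {1} (zeros-periodic 1))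
        (blocks (splice K s zeros) K) (blocks zeros K)
        (weylZero-cong (dill-splice K s zeros) (dill-blocks K zeros)
          (wd _ zeros (finiteDifference⇒weylZero _ zeros K (λ p K≤p → splice-≥ K s zeros K≤p))))

    module _ (defect : LengthDefect) where
      open LengthDefect defect

      gap = length (blocks t K) ∸ length (blocks s K)

      1≤gap : 1 ≤ gap
      1≤gap = ℕP.m<n⇒0<n∸m shorter

      -- splicing s or t in front of z prefixes F z with words whose lengths differ by gap,
      -- and the two results are at Weyl distance zero since they are images of Weyl-equivalent sequences
      dill-periodic-defect : ∀ {z m} → 1 ≤ m → Periodic z m → Periodic (dill f z) gap
      dill-periodic-defect {z} {m} 1≤m per = periodic-agree-tail 1≤P (periodic-drop perFz gap) perFz T tail≡
        where
        open ≡-Reasoning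
        X = splice (K + θ) s z
        Y = splice (K + θ) t z
        perFz = dill-periodic per
        1≤P = ℕP.≤-trans 1≤m (blocks-length-≥ m z)
        X≈Y = splice-cong-≥ (K + θ) z K agree
        shifted : ∀ i → dill f z (length (blocks Y (K + θ)) + i) ≡ dill f z (length (blocks X (K + θ)) + i)
        shifted = weylZero-++ˢ-periodic 1≤P perFz (blocks X (K + θ)) (blocks Y (K + θ))
          (weylZero-cong (dill-splice (K + θ) s z) (dill-splice (K + θ) t z)
            (wd X Y (finiteDifference⇒weylZero X Y K X≈Y)))
        E = length (blocks (drop K X) θ)
        T = length (blocks s K) + E
        lengthY : length (blocks Y (K + θ)) ≡ gap + T
        lengthY = begin
          length (blocks Y (K + θ))
            ≡⟨ length-blocks-splice K t z ⟩
          length (blocks t K) + length (blocks (drop K Y) θ)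
            ≡⟨ cong (λ w → length (blocks t K) + length w)
                 (blocks-local θ (drop K Y) (drop K X) (λ i _ → sym (X≈Y (K + i) (ℕP.m≤m+n K i)))) ⟩
          length (blocks t K) + E
            ≡⟨ cong (_+ E) (ℕP.m+[n∸m]≡n (ℕP.<⇒≤ shorter)) ⟨
          length (blocks s K) + gap + E
            ≡⟨ ar (length (blocks s K)) gap E ⟩
          gap + T ∎
          where
          ar : ∀ a d e → a + d + e ≡ d + (a + e)
          ar = solve-∀
        tail≡ : ∀ i → dill f z (gap + (T + i)) ≡ dill f z (T + i)
        tail≡ i = begin
          dill f z (gap + (T + i))                 ≡⟨ cong (dill f z) (trans (sym (ℕP.+-assoc gap T i)) (cong (_+ i) (sym lengthY))) ⟩
          dill f z (length (blocks Y (K + θ)) + i) ≡⟨ shifted i ⟩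
          dill f z (length (blocks X (K + θ)) + i) ≡⟨ cong (λ n → dill f z (n + i)) (length-blocks-splice K s z) ⟩
          dill f z (T + i)                         ∎

      dill-periodic-agree : ∀ {z z′ m m′} → 1 ≤ m → Periodic z m → 1 ≤ m′ → Periodic z′ m′ →
        (∀ i → i < gap + θ → z i ≡ z′ i) → ∀ i → dill f z i ≡ dill f z′ i
      dill-periodic-agree 1≤m per 1≤m′ per′ z≡z′ =
        periodic-agree-< 1≤gap (dill-periodic-defect 1≤m per) (dill-periodic-defect 1≤m′ per′)
          (λ i i<gap → dill-local gap _ _ (λ j sj<gap+θ → z≡z′ j (ℕP.<-trans (ℕP.n<1+n j) sj<gap+θ)) i<gap)

      -- v is periodic and starts with M letters of z followed by M zeros: so F v agrees with F z,
      -- F v agrees with F zeros after the first M blocks, and that shift leaves F zeros invariant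
      dill-periodic≡zeros : ∀ {z m} → 1 ≤ m → Periodic z m → ∀ i → dill f z i ≡ dill f zeros i
      dill-periodic≡zeros {z} {m} 1≤m per = periodic-agree-tail 1≤gap (dill-periodic-defect 1≤m per)
        (dill-periodic-defect {zeros} {1} (s≤s z≤n) (zeros-periodic 1)) p tail≡
        where
        open ≡-Reasoning
        M = gap + θ
        X = splice M z zeros
        N = suc (M + M)
        v = periodise N X
        v≡X : ∀ {i} → i < N → v i ≡ X i
        v≡X i<N = periodise-< N X i<N
        perv : Periodic v N
        perv = periodise-periodic N X
        p = length (blocks v M)
        p≡ : p ≡ length (blocks X M)
        p≡ = cong length (blocks-local M v X (λ i si<M+θ → v≡X (ℕP.≤-trans (ℕP.<-trans (ℕP.n<1+n i) si<M+θ) (ℕP.≤-trans (ℕP.+-monoʳ-≤ M (ℕP.m≤n+m θ gap)) (ℕP.n≤1+n _)))))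
        Fv≡Fz : ∀ i → dill f v i ≡ dill f z i
        Fv≡Fz = dill-periodic-agree (s≤s z≤n) perv 1≤m per
          (λ i i<M → trans (v≡X (ℕP.<-trans (ℕP.<-≤-trans i<M (ℕP.m≤m+n M M)) (ℕP.n<1+n (M + M)))) (splice-< M z zeros i<M))
        Fdrop≡zeros : ∀ i → dill f (drop M v) i ≡ dill f zeros i
        Fdrop≡zeros = dill-periodic-agree {m′ = 1} (s≤s z≤n) (periodic-drop perv M) (s≤s z≤n) (zeros-periodic 1)
          (λ i i<M → trans (v≡X (s≤s (ℕP.+-monoʳ-≤ M (ℕP.<⇒≤ i<M)))) (splice-≥ M z zeros (ℕP.m≤m+n M i)))
        tail≡ : ∀ i → dill f z (p + i) ≡ dill f zeros (p + i)
        tail≡ i = begin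
          dill f z (p + i)                       ≡⟨ Fv≡Fz (p + i) ⟨
          dill f v (p + i)                       ≡⟨ dill-drop M v i ⟩
          dill f (drop M v) i                    ≡⟨ Fdrop≡zeros i ⟩
          dill f zeros i                         ≡⟨ dill-zeros-periodic-splice M z i ⟨
          dill f zeros (length (blocks X M) + i) ≡⟨ cong (λ n → dill f zeros (n + i)) p≡ ⟨
          dill f zeros (p + i)                   ∎

      defect⇒constant : IsConstant (dill f)
      defect⇒constant x y n = trans (≡zeros x) (sym (≡zeros y))
        where
        ≡zeros : ∀ x → dill f x n ≡ dill f zeros n
        ≡zeros x = trans
          (dill-local (suc n) x (periodise P x) (λ i si<P → sym (periodise-< P x (ℕP.<-trans (ℕP.n<1+n i) si<P))) (ℕP.n<1+n n))
          (dill-periodic≡zeros (s≤s z≤n) (periodise-periodic P x) n)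
          where P = suc (n + θ)

  noDefect⇒length-blocks-≡ : ¬ LengthDefect → ∀ K (x y : Seq k) → (∀ p → K ≤ p → x p ≡ y p) →
    length (blocks x K) ≡ length (blocks y K)
  noDefect⇒length-blocks-≡ noDefect K x y agree with ℕP.<-cmp (length (blocks x K)) (length (blocks y K))
  ... | tri< lt _ _ = ⊥-elim (noDefect (record { K = K ; s = x ; t = y ; agree = agree ; shorter = lt }))
  ... | tri≈ _ eq _ = eq
  ... | tri> _ _ gt = ⊥-elim (noDefect (record { K = K ; s = y ; t = x ; agree = λ p K≤p → sym (agree p K≤p) ; shorter = gt }))

  firstBlockLength : Seq k → ℕ
  firstBlockLength x = length (firstBlock x)

  firstBlockLength-cong : ∀ (x y : Seq k) → (∀ i → x i ≡ y i) → firstBlockLength x ≡ firstBlockLength y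
  firstBlockLength-cong x y x≗y = cong (λ w → length (toList (f w))) (window-cong x y x≗y)

  length-blocks-cong : ∀ K (x y : Seq k) → (∀ j → j < K → firstBlockLength (drop j x) ≡ firstBlockLength (drop j y)) →
    length (blocks x K) ≡ length (blocks y K)
  length-blocks-cong zero x y _ = refl
  length-blocks-cong (suc K) x y same = begin
    length (firstBlock x ++ blocks (shift x) K)
      ≡⟨ ListP.length-++ (firstBlock x) ⟩
    firstBlockLength x + length (blocks (shift x) K)
      ≡⟨ cong₂ _+_ (same 0 (s≤s z≤n)) (length-blocks-cong K (shift x) (shift y) (λ j j<K → same (suc j) (s≤s j<K))) ⟩
    firstBlockLength y + length (blocks (shift y) K)
      ≡⟨ ListP.length-++ (firstBlock y) ⟨
    length (firstBlock y ++ blocks (shift y) K) ∎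
    where open ≡-Reasoning

  -- blocks 1, …, r of zeroPrefix r x and zeroPrefix (r + 1) x differ only within their first r
  -- letters, so they have equal lengths by induction; as there is no defect, so do the first blocks
  noDefect⇒firstBlockLength-zeroPrefix : ¬ LengthDefect → ∀ r x → firstBlockLength x ≡ firstBlockLength (zeroPrefix r x)
  noDefect⇒firstBlockLength-zeroPrefix noDefect zero x = firstBlockLength-cong x (zeroPrefix 0 x) (λ i → sym (zeroPrefix-≥ 0 x z≤n))
  noDefect⇒firstBlockLength-zeroPrefix noDefect (suc r) x = trans (IH x) (ℕP.+-cancelʳ-≡ B _ _ sumsEqual)
    where
    IH = noDefect⇒firstBlockLength-zeroPrefix noDefect r
    x₁ = zeroPrefix r x
    x₂ = zeroPrefix (suc r) x
    x₁≈x₂ : ∀ p → suc r ≤ p → x₁ p ≡ x₂ p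
    x₁≈x₂ p r<p = trans (zeroPrefix-≥ r x (ℕP.<⇒≤ r<p)) (sym (zeroPrefix-≥ (suc r) x r<p))
    zeroPrefix-drop : ∀ j i → zeroPrefix r (drop j (shift x₁)) i ≡ zeroPrefix r (drop j (shift x₂)) i
    zeroPrefix-drop j = zeroPrefix-cong r (λ i r≤i → x₁≈x₂ (suc (j + i)) (s≤s (ℕP.≤-trans r≤i (ℕP.m≤n+m i j))))
    B = length (blocks (shift x₁) r)
    B≡ : B ≡ length (blocks (shift x₂) r)
    B≡ = length-blocks-cong r (shift x₁) (shift x₂) (λ j _ →
      trans (IH (drop j (shift x₁))) (trans (firstBlockLength-cong _ _ (zeroPrefix-drop j)) (sym (IH (drop j (shift x₂))))))
    sumsEqual : firstBlockLength x₁ + B ≡ firstBlockLength x₂ + B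
    sumsEqual = trans (sym (ListP.length-++ (firstBlock x₁))) (trans (noDefect⇒length-blocks-≡ noDefect (suc r) x₁ x₂ x₁≈x₂)
      (trans (ListP.length-++ (firstBlock x₂)) (cong (λ r → firstBlockLength x₂ + r) (sym B≡))))

  noDefect⇒len-≡ : ¬ LengthDefect → ∀ u → len f u ≡ firstBlockLength zeros
  noDefect⇒len-≡ noDefect u = begin
    len f u                                     ≡⟨ cong (len f) (window-extend u) ⟨
    firstBlockLength (extend u)                 ≡⟨ noDefect⇒firstBlockLength-zeroPrefix noDefect θ (extend u) ⟩
    firstBlockLength (zeroPrefix θ (extend u))  ≡⟨ firstBlockLength-cong _ _ (zeroPrefix-cong θ (λ i θ≤i → extend-≥ u θ≤i)) ⟩
    firstBlockLength (zeroPrefix θ zeros)       ≡⟨ noDefect⇒firstBlockLength-zeroPrefix noDefect θ zeros ⟨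
    firstBlockLength zeros                      ∎
    where open ≡-Reasoning

  len-≡? : Dec (∀ u → len f u ≡ firstBlockLength zeros)
  len-≡? = Dec.map′ (λ all u → All.lookup all (allWords-complete k θ u)) (λ same → All.tabulate (λ {u} _ → same u))
    (All.all? (λ u → len f u ℕP.≟ firstBlockLength zeros) (allWords k θ))

  -- uniformity and the equations dill f x n ≡ dill f y n are decidable, so refuting the
  -- existence of a defect suffices
  wellDefined⇒constant⊎uniform : WeylWellDefined (dill f) → IsConstant (dill f) ⊎ IsUniform f
  wellDefined⇒constant⊎uniform wd with len-≡?
  ... | yes same = inj₂ (λ u v → trans (same u) (sym (same v)))
  ... | no ¬same = inj₁ (λ x y n → decidable-stable (dill f x n Fin.≟ dill f y n)
    (λ ≢ → ¬same (noDefect⇒len-≡ (λ defect → ≢ (defect⇒constant wd defect x y n)))))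

-- Constant or uniform ⇒ Lipschitz

foldr-⊔-≥ : ∀ {A : Set} (g : A → ℕ) z xs {v} → v ∈ xs → g v ≤ foldr (λ v m → g v ⊔ m) z xs
foldr-⊔-≥ g z (v ∷ xs) (here refl) = ℕP.m≤m⊔n (g v) _
foldr-⊔-≥ g z (w ∷ xs) (there v∈xs) = ℕP.≤-trans (foldr-⊔-≥ g z xs v∈xs) (ℕP.m≤n⊔m (g w) _)

foldr-⊔-≥-init : ∀ {A : Set} (g : A → ℕ) z xs → z ≤ foldr (λ v m → g v ⊔ m) z xs
foldr-⊔-≥-init g z [] = ℕP.≤-refl
foldr-⊔-≥-init g z (w ∷ xs) = ℕP.≤-trans (foldr-⊔-≥-init g z xs) (ℕP.m≤n⊔m (g w) _)

≡ᵇ-refl : ∀ n → (n ≡ᵇ n) ≡ true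
≡ᵇ-refl zero = refl
≡ᵇ-refl (suc n) = ≡ᵇ-refl n

if-≡ᵇ-then : ∀ {a b} (x : ℕ) → a ≡ b → (if a ≡ᵇ b then x else 0) ≡ x
if-≡ᵇ-then {a} x refl rewrite ≡ᵇ-refl a = refl

hamL-refl : ∀ {n} (w : List (Fin n)) → hamL w w ≡ 0
hamL-refl [] = refl
hamL-refl (a ∷ w) with a ≟ a
... | yes _ = hamL-refl w
... | no a≢a = ⊥-elim (a≢a refl)

module _ {k θ : ℕ} (f : LocalRule k θ) where

  private
    distance : Vec (Fin (suc k)) θ → Vec (Fin (suc k)) θ → ℕ
    distance u v = if len f u ≡ᵇ len f v then hamL (toList (f u)) (toList (f v)) else 0

    distance-≤-Delta : ∀ us {u} v → u ∈ us →
      distance u v ≤ foldr (λ u m → foldr (λ v m′ → distance u v ⊔ m′) m (allWords k θ)) 0 us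
    distance-≤-Delta (u ∷ us) v (here refl) = foldr-⊔-≥ (distance u) _ (allWords k θ) (allWords-complete k θ v)
    distance-≤-Delta (w ∷ us) v (there u∈us) =
      ℕP.≤-trans (distance-≤-Delta us v u∈us) (foldr-⊔-≥-init (distance w) _ (allWords k θ))

  hamL-≤-Delta : ∀ u v → len f u ≡ len f v → hamL (toList (f u)) (toList (f v)) ≤ Delta f
  hamL-≤-Delta u v |u|≡|v| = subst (_≤ Delta f) (if-≡ᵇ-then _ |u|≡|v|)
    (distance-≤-Delta (allWords k θ) v (allWords-complete k θ u))

  lipConst-nonNeg : 0ℚ ℚ.≤ lipConst f
  lipConst-nonNeg = *-≤⇒/-≤ 0 0 (θ * Delta f) _ z≤n

  module Uniform (uniform : IsUniform f) where
    open Dill f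

    m₀ : ℕ
    m₀ = length (tail (f (replicate θ Fin.zero)))

    m : ℕ
    m = suc m₀

    len≡m : ∀ u → len f u ≡ m
    len≡m u = uniform u (replicate θ Fin.zero)

    lipConst≡ : lipConst f ≡ (+ (θ * Delta f)) / m
    lipConst≡ = cong (λ n → (+ (θ * Delta f)) / suc n) (go (allWords k θ))
      where
      go : ∀ us → foldr (λ u n → length (tail (f u)) ⊓ n) m₀ us ≡ m₀
      go [] = refl
      go (u ∷ us) = trans (cong₂ _⊓_ (ℕP.suc-injective (len≡m u)) (go us)) (ℕP.⊓-idem m₀)

    length-blocks : ∀ K x → length (blocks x K) ≡ K * m
    length-blocks zero x = refl
    length-blocks (suc K) x = trans (ListP.length-++ (firstBlock x)) (cong₂ _+_ (len≡m _) (length-blocks K (shift x)))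

    dill-block : ∀ j x r → dill f x (j * m + r) ≡ dill f (drop j x) r
    dill-block j x r = trans (cong (λ n → dill f x (n + r)) (sym (length-blocks j x))) (dill-drop j x r)

    hamWin-++ˢ : ∀ u v (s t : Seq k) → length u ≡ length v → hamWin (u ++ˢ s) (v ++ˢ t) 0 (length u) ≡ hamL u v
    hamWin-++ˢ [] [] s t _ = refl
    hamWin-++ˢ (a ∷ u) (b ∷ v) s t |u|≡|v| with a ≟ b
    ... | yes _ = trans (hamWin-drop _ _ 1 0 (length u)) (hamWin-++ˢ u v s t (ℕP.suc-injective |u|≡|v|))
    ... | no _ = cong suc (trans (hamWin-drop _ _ 1 0 (length u)) (hamWin-++ˢ u v s t (ℕP.suc-injective |u|≡|v|)))

    hamWin-dill-block : ∀ x y j → hamWin (dill f x) (dill f y) (j * m) m ≤ Delta f * hamWin x y j θ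
    hamWin-dill-block x y j = subst (_≤ Delta f * hamWin x y j θ) (sym block≡) (bound (hamWin x y j θ) refl)
      where
      open ≡-Reasoning
      x′ = drop j x
      y′ = drop j y
      block≡ : hamWin (dill f x) (dill f y) (j * m) m ≡ hamL (firstBlock x′) (firstBlock y′)
      block≡ = begin
        hamWin (dill f x) (dill f y) (j * m) m
          ≡⟨ cong (λ n → hamWin (dill f x) (dill f y) n m) (ℕP.+-identityʳ (j * m)) ⟨
        hamWin (dill f x) (dill f y) (j * m + 0) m
          ≡⟨ hamWin-drop (dill f x) (dill f y) (j * m) 0 m ⟩
        hamWin (drop (j * m) (dill f x)) (drop (j * m) (dill f y)) 0 m
          ≡⟨ hamWin-cong (λ r → trans (dill-block j x r) (dill-unfold x′ r)) (λ r → trans (dill-block j y r) (dill-unfold y′ r)) 0 m ⟩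
        hamWin (firstBlock x′ ++ˢ dill f (shift x′)) (firstBlock y′ ++ˢ dill f (shift y′)) 0 m
          ≡⟨ cong (hamWin (firstBlock x′ ++ˢ dill f (shift x′)) (firstBlock y′ ++ˢ dill f (shift y′)) 0) (len≡m (window θ x′ 0)) ⟨
        hamWin (firstBlock x′ ++ˢ dill f (shift x′)) (firstBlock y′ ++ˢ dill f (shift y′)) 0 (length (firstBlock x′))
          ≡⟨ hamWin-++ˢ (firstBlock x′) (firstBlock y′) _ _ (trans (len≡m _) (sym (len≡m _))) ⟩
        hamL (firstBlock x′) (firstBlock y′) ∎
      bound : ∀ h → hamWin x y j θ ≡ h → hamL (firstBlock x′) (firstBlock y′) ≤ Delta f * h
      bound zero window≡0 = ℕP.≤-reflexive (begin
        hamL (firstBlock x′) (firstBlock y′) ≡⟨ cong (hamL (firstBlock x′)) (firstBlock-local x′ y′ (hamWin≡0⇒≡ x y j θ window≡0)) ⟨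
        hamL (firstBlock x′) (firstBlock x′) ≡⟨ hamL-refl (firstBlock x′) ⟩
        0                                    ≡⟨ ℕP.*-zeroʳ (Delta f) ⟨
        Delta f * 0                          ∎)
      bound (suc h) _ = ℕP.≤-trans (hamL-≤-Delta (window θ x′ 0) (window θ y′ 0) (trans (len≡m _) (sym (len≡m _))))
        (ℕP.m≤m*n (Delta f) (suc h))

    hamWin-dill-blocks : ∀ x y B j →
      hamWin (dill f x) (dill f y) (j * m) (B * m) ≤ Delta f * sumFrom (λ t → hamWin x y t θ) j B
    hamWin-dill-blocks x y zero j = z≤n
    hamWin-dill-blocks x y (suc B) j = begin
      hamWin (dill f x) (dill f y) (j * m) (m + B * m)
        ≡⟨ hamWin-+ (dill f x) (dill f y) (j * m) m (B * m) ⟩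
      hamWin (dill f x) (dill f y) (j * m) m + hamWin (dill f x) (dill f y) (j * m + m) (B * m)
        ≡⟨ cong (λ n → hamWin (dill f x) (dill f y) (j * m) m + hamWin (dill f x) (dill f y) n (B * m)) (ℕP.+-comm (j * m) m) ⟩
      hamWin (dill f x) (dill f y) (j * m) m + hamWin (dill f x) (dill f y) (suc j * m) (B * m)
        ≤⟨ ℕP.+-mono-≤ (hamWin-dill-block x y j) (hamWin-dill-blocks x y B (suc j)) ⟩
      Delta f * hamWin x y j θ + Delta f * sumFrom (λ t → hamWin x y t θ) (suc j) B
        ≡⟨ ℕP.*-distribˡ-+ (Delta f) (hamWin x y j θ) _ ⟨
      Delta f * sumFrom (λ t → hamWin x y t θ) j (suc B) ∎
      where open ℕP.≤-Reasoning

    span : ℕ → ℕ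
    span ℓ = suc (suc (ℓ ℕ./ m))

    span-*-≤ : ∀ ℓ → span ℓ * m ≤ suc ℓ + 2 * m
    span-*-≤ ℓ = subst (_≤ suc ℓ + 2 * m) (sym (ar (ℓ ℕ./ m) m))
      (ℕP.+-monoˡ-≤ (2 * m) (ℕP.≤-trans (m/n*n≤m ℓ m) (ℕP.n≤1+n ℓ)))
      where
      ar : ∀ a m → suc (suc a) * m ≡ a * m + 2 * m
      ar = solve-∀

    -- the window of length ℓ+1 at i lies inside the span ℓ blocks starting with block i / m
    hamWin-dill-≤ : ∀ x y i ℓ →
      hamWin (dill f x) (dill f y) i (suc ℓ) ≤ Delta f * sumFrom (λ c → hamWin x y c (span ℓ)) (i ℕ./ m) θ
    hamWin-dill-≤ x y i ℓ = begin
      hamWin (dill f x) (dill f y) i (suc ℓ)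
        ≡⟨ cong (λ n → hamWin (dill f x) (dill f y) n (suc ℓ)) i≡ ⟩
      hamWin (dill f x) (dill f y) (j * m + i % m) (suc ℓ)
        ≤⟨ hamWin-mono (dill f x) (dill f y) (j * m) (i % m) (suc ℓ) (span ℓ * m) covered ⟩
      hamWin (dill f x) (dill f y) (j * m) (span ℓ * m)
        ≤⟨ hamWin-dill-blocks x y (span ℓ) j ⟩
      Delta f * sumFrom (λ t → hamWin x y t θ) j (span ℓ)
        ≡⟨ cong (Delta f *_) (sumFrom-hamWin-comm x y j (span ℓ) θ) ⟩
      Delta f * sumFrom (λ c → hamWin x y c (span ℓ)) j θ ∎
      where
      open ℕP.≤-Reasoning
      j = i ℕ./ m
      i≡ : i ≡ j * m + i % m
      i≡ = trans (m≡m%n+[m/n]*n i m) (ℕP.+-comm (i % m) (j * m))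
      covered : i % m + suc ℓ ≤ span ℓ * m
      covered = subst (i % m + suc ℓ ≤_) (sym (ar (ℓ ℕ./ m) m))
        (ℕP.+-mono-≤ (ℕP.<⇒≤ (m%n<n i m))
          (subst (_≤ m + ℓ ℕ./ m * m) (cong suc (sym (m≡m%n+[m/n]*n ℓ m))) (ℕP.+-monoˡ-≤ (ℓ ℕ./ m * m) (m%n<n ℓ m))))
        where
        ar : ∀ a m → suc (suc a) * m ≡ m + (m + a * m)
        ar = solve-∀

    N : ℕ
    N = θ * Delta f

    lipConst-*-m : lipConst f ℚ.* fromℕ m ≡ fromℕ N
    lipConst-*-m = trans (cong (ℚ._* fromℕ m) lipConst≡) (/-*-fromℕ N m₀)

    lipConst-≤ : lipConst f ℚ.≤ fromℕ N
    lipConst-≤ = subst (ℚ._≤ fromℕ N) (sym lipConst≡) (*-≤⇒/-≤ N m₀ N 0 (ℕP.*-monoʳ-≤ N (s≤s z≤n)))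

    α : ℚ
    α = (+ 1) / suc (suc (N + N))

    α-pos : 0ℚ ℚ.< α
    α-pos = /-pos 0 (suc (N + N))

    N/[2N+2]≤½ : (+ N) / suc (suc (N + N)) ℚ.≤ ½
    N/[2N+2]≤½ = *-≤⇒/-≤ N (suc (N + N)) 1 1 (begin
      N * 2                  ≡⟨ ℕP.*-comm N 2 ⟩
      N + (N + 0)            ≡⟨ cong (λ n → N + n) (ℕP.+-identityʳ N) ⟩
      N + N                  ≤⟨ ℕP.≤-trans (ℕP.n≤1+n (N + N)) (ℕP.n≤1+n _) ⟩
      suc (suc (N + N))      ≡⟨ ℕP.*-identityˡ _ ⟨
      1 * suc (suc (N + N))  ∎)
      where open ℕP.≤-Reasoning

    lipConst-*-α-≤ : ∀ ε → 0ℚ ℚ.≤ ε → lipConst f ℚ.* (ε ℚ.* α) ℚ.≤ ½ ℚ.* ε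
    lipConst-*-α-≤ ε 0≤ε = begin
      lipConst f ℚ.* (ε ℚ.* α)          ≤⟨ ℚP.*-monoʳ-≤-nonNeg (ε ℚ.* α) {{ℚP.nonNeg*nonNeg⇒nonNeg ε {{ℚ.nonNegative 0≤ε}} α {{ℚ.nonNegative (ℚP.<⇒≤ α-pos)}}}} lipConst-≤ ⟩
      fromℕ N ℚ.* (ε ℚ.* α)             ≡⟨ solve 3 (λ n e a → n :* (e :* a) := (n :* a) :* e) refl (fromℕ N) ε α ⟩
      (fromℕ N ℚ.* α) ℚ.* ε             ≡⟨ cong (ℚ._* ε) (fromℕ-*-1/ N (suc (N + N))) ⟩
      ((+ N) / suc (suc (N + N))) ℚ.* ε ≤⟨ ℚP.*-monoʳ-≤-nonNeg ε {{ℚ.nonNegative 0≤ε}} N/[2N+2]≤½ ⟩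
      ½ ℚ.* ε                           ∎
      where
      open ℚP.≤-Reasoning
      open +-*-Solver

    fromℕ-hamWin-dill-≤ : ∀ x y R ℓ i → 0ℚ ℚ.≤ R →
      (∀ c → fromℕ (hamWin x y c (span ℓ)) ℚ.≤ R ℚ.* fromℕ (span ℓ)) →
      fromℕ (hamWin (dill f x) (dill f y) i (suc ℓ)) ℚ.≤ lipConst f ℚ.* R ℚ.* (fromℕ (suc ℓ) ℚ.+ fromℕ 2 ℚ.* fromℕ m)
    fromℕ-hamWin-dill-≤ x y R ℓ i 0≤R window≤ = begin
      fromℕ (hamWin (dill f x) (dill f y) i (suc ℓ))
        ≤⟨ fromℕ-mono-≤ (hamWin-dill-≤ x y i ℓ) ⟩
      fromℕ (Delta f * sumFrom (λ c → hamWin x y c B) (i ℕ./ m) θ)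
        ≡⟨ fromℕ-* (Delta f) _ ⟩
      fromℕ (Delta f) ℚ.* fromℕ (sumFrom (λ c → hamWin x y c B) (i ℕ./ m) θ)
        ≤⟨ ℚP.*-monoˡ-≤-nonNeg (fromℕ (Delta f)) {{ℚ.nonNegative (fromℕ-nonNeg (Delta f))}}
             (fromℕ-sumFrom-≤ (λ c → hamWin x y c B) (R ℚ.* fromℕ B) (i ℕ./ m) θ window≤) ⟩
      fromℕ (Delta f) ℚ.* (fromℕ θ ℚ.* (R ℚ.* fromℕ B))
        ≡⟨ solve 4 (λ D t r b → D :* (t :* (r :* b)) := (t :* D) :* r :* b) refl (fromℕ (Delta f)) (fromℕ θ) R (fromℕ B) ⟩
      fromℕ θ ℚ.* fromℕ (Delta f) ℚ.* R ℚ.* fromℕ B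
        ≡⟨ cong (λ n → n ℚ.* R ℚ.* fromℕ B) (trans (sym (fromℕ-* θ (Delta f))) (sym lipConst-*-m)) ⟩
      lipConst f ℚ.* fromℕ m ℚ.* R ℚ.* fromℕ B
        ≡⟨ solve 4 (λ c m r b → c :* m :* r :* b := c :* r :* (m :* b)) refl (lipConst f) (fromℕ m) R (fromℕ B) ⟩
      lipConst f ℚ.* R ℚ.* (fromℕ m ℚ.* fromℕ B)
        ≤⟨ ℚP.*-monoˡ-≤-nonNeg (lipConst f ℚ.* R)
             {{ℚP.nonNeg*nonNeg⇒nonNeg (lipConst f) {{ℚ.nonNegative lipConst-nonNeg}} R {{ℚ.nonNegative 0≤R}}}} span≤ ⟩
      lipConst f ℚ.* R ℚ.* (fromℕ (suc ℓ) ℚ.+ fromℕ 2 ℚ.* fromℕ m) ∎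
      where
      open ℚP.≤-Reasoning
      open +-*-Solver
      B = span ℓ
      span≤ : fromℕ m ℚ.* fromℕ B ℚ.≤ fromℕ (suc ℓ) ℚ.+ fromℕ 2 ℚ.* fromℕ m
      span≤ = subst₂ ℚ._≤_ (trans (cong fromℕ (ℕP.*-comm B m)) (fromℕ-* m B))
        (trans (fromℕ-+ (suc ℓ) (2 * m)) (cong (fromℕ (suc ℓ) ℚ.+_) (fromℕ-* 2 m))) (fromℕ-mono-≤ (span-*-≤ ℓ))

    -- with q + ε′ as window density, the ε′ part and the boundary term 2N(q + ε′) each cost at most ε/2
    uniform⇒lipschitz : WeylLipschitz (dill f) (lipConst f)
    uniform⇒lipschitz x y q x~y ε ε>0 = L * m + L₀ , bound
      where
      open +-*-Solver
      c = lipConst f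
      ε′ = ε ℚ.* α
      ε′>0 : 0ℚ ℚ.< ε′
      ε′>0 = ℚP.positive⁻¹ ε′ {{ℚP.pos*pos⇒pos ε {{ℚ.positive ε>0}} α {{ℚ.positive α-pos}}}}
      L = proj₁ (x~y ε′ ε′>0)
      R = q ℚ.+ ε′
      0≤R : 0ℚ ℚ.≤ R
      0≤R = ℚP.≤-trans (weylLe-nonNeg {x = x} {y} {q} x~y)
        (ℚP.≤-trans (ℚP.≤-reflexive (sym (ℚP.+-identityʳ q))) (ℚP.+-monoʳ-≤ q (ℚP.<⇒≤ ε′>0)))
      boundary = archimedean (fromℕ 2 ℚ.* fromℕ N ℚ.* R) (½ ℚ.* ε) (ℚP.*-monoʳ-<-pos ½ {{_}} ε>0)
      L₀ = proj₁ boundary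
      bound : ∀ ℓ → L * m + L₀ ≤ ℓ → ∀ i → (+ hamWin (dill f x) (dill f y) i (suc ℓ)) / suc ℓ ℚ.≤ c ℚ.* q ℚ.+ ε
      bound ℓ L′≤ℓ i = ≤-*-fromℕ⇒/-≤ (hamWin (dill f x) (dill f y) i (suc ℓ)) ℓ (c ℚ.* q ℚ.+ ε) (begin
        fromℕ (hamWin (dill f x) (dill f y) i (suc ℓ))
          ≤⟨ fromℕ-hamWin-dill-≤ x y R ℓ i 0≤R window≤ ⟩
        c ℚ.* R ℚ.* (S ℚ.+ fromℕ 2 ℚ.* fromℕ m)
          ≡⟨ solve 6 (λ c q e s t m → c :* (q :+ e) :* (s :+ t :* m) := c :* q :* s :+ c :* e :* s :+ t :* (c :* m) :* (q :+ e))
               refl c q ε′ S (fromℕ 2) (fromℕ m) ⟩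
        c ℚ.* q ℚ.* S ℚ.+ c ℚ.* ε′ ℚ.* S ℚ.+ fromℕ 2 ℚ.* (c ℚ.* fromℕ m) ℚ.* R
          ≡⟨ cong (λ n → c ℚ.* q ℚ.* S ℚ.+ c ℚ.* ε′ ℚ.* S ℚ.+ fromℕ 2 ℚ.* n ℚ.* R) lipConst-*-m ⟩
        c ℚ.* q ℚ.* S ℚ.+ c ℚ.* ε′ ℚ.* S ℚ.+ fromℕ 2 ℚ.* fromℕ N ℚ.* R
          ≤⟨ ℚP.+-mono-≤ (ℚP.+-monoʳ-≤ (c ℚ.* q ℚ.* S)
               (ℚP.*-monoʳ-≤-nonNeg S {{ℚ.nonNegative (fromℕ-nonNeg (suc ℓ))}} (lipConst-*-α-≤ ε (ℚP.<⇒≤ ε>0))))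
               (proj₂ boundary (suc ℓ) (ℕP.≤-trans (ℕP.m≤n+m L₀ (L * m)) (ℕP.≤-trans L′≤ℓ (ℕP.n≤1+n ℓ)))) ⟩
        c ℚ.* q ℚ.* S ℚ.+ ½ ℚ.* ε ℚ.* S ℚ.+ ½ ℚ.* ε ℚ.* S
          ≡⟨ solve 3 (λ a e s → a :* s :+ con ½ :* e :* s :+ con ½ :* e :* s := (a :+ e) :* s) refl (c ℚ.* q) ε S ⟩
        (c ℚ.* q ℚ.+ ε) ℚ.* S ∎)
        where
        open ℚP.≤-Reasoning
        S = fromℕ (suc ℓ)
        L≤ℓ/m+1 : L ≤ suc (ℓ ℕ./ m)
        L≤ℓ/m+1 = ℕP.≤-trans (ℕP.≤-reflexive (sym (m*n/n≡m L m)))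
          (ℕP.≤-trans (/-monoˡ-≤ m (ℕP.≤-trans (ℕP.m≤m+n (L * m) L₀) L′≤ℓ)) (ℕP.n≤1+n _))
        window≤ : ∀ c′ → fromℕ (hamWin x y c′ (span ℓ)) ℚ.≤ R ℚ.* fromℕ (span ℓ)
        window≤ c′ = /-≤⇒≤-*-fromℕ (hamWin x y c′ (span ℓ)) (suc (ℓ ℕ./ m)) R (proj₂ (x~y ε′ ε′>0) _ L≤ℓ/m+1 c′)

module _ {k θ : ℕ} (f : LocalRule k θ) where

  constant⇒lipschitz : IsConstant (dill f) → WeylLipschitz (dill f) (lipConst f)
  constant⇒lipschitz constant x y q x~y ε ε>0 = 0 , λ ℓ _ i → begin
    (+ hamWin (dill f x) (dill f y) i (suc ℓ)) / suc ℓ ≡⟨ cong (λ h → (+ h) / suc ℓ) (noMismatch i (suc ℓ)) ⟩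
    (+ 0) / suc ℓ                                      ≤⟨ *-≤⇒/-≤ 0 ℓ 0 0 z≤n ⟩
    0ℚ                                                 ≤⟨ ℚP.nonNegative⁻¹ _ {{ℚP.nonNeg*nonNeg⇒nonNeg (lipConst f) {{ℚ.nonNegative (lipConst-nonNeg f)}} q {{ℚ.nonNegative (weylLe-nonNeg {x = x} {y} {q} x~y)}}}} ⟩
    lipConst f ℚ.* q                                   ≡⟨ ℚP.+-identityʳ (lipConst f ℚ.* q) ⟨
    lipConst f ℚ.* q ℚ.+ 0ℚ                            ≤⟨ ℚP.+-monoʳ-≤ (lipConst f ℚ.* q) (ℚP.<⇒≤ ε>0) ⟩
    lipConst f ℚ.* q ℚ.+ ε                             ∎
    where
    open ℚP.≤-Reasoning
    noMismatch : ∀ i ℓ → hamWin (dill f x) (dill f y) i ℓ ≡ 0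
    noMismatch i ℓ = ℕP.n≤0⇒n≡0 (ℕP.≤-trans (hamWin-≤-∸ (dill f x) (dill f y) 0 (λ p _ → constant x y p) i ℓ) (ℕP.≤-reflexive (ℕP.0∸n≡0 i)))

  lipschitz⇒wellDefined : WeylLipschitz (dill f) (lipConst f) → WeylWellDefined (dill f)
  lipschitz⇒wellDefined lipschitz x y x~y = subst (WeylLe (dill f x) (dill f y)) (ℚP.*-zeroʳ (lipConst f)) (lipschitz x y 0ℚ x~y)

theorem2 : (k θ : ℕ) → 1 ≤ θ → (f : LocalRule k θ) →
    (WeylWellDefined (dill f) ⇔ WeylLipschitz (dill f) (lipConst f))
    × (WeylLipschitz (dill f) (lipConst f) ⇔ (IsConstant (dill f) ⊎ IsUniform f))
theorem2 k θ _ f =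
  mk⇔ (λ wd → constant⊎uniform⇒lipschitz (wellDefined⇒constant⊎uniform f wd)) (lipschitz⇒wellDefined f) ,
  mk⇔ (λ lip → wellDefined⇒constant⊎uniform f (lipschitz⇒wellDefined f lip)) constant⊎uniform⇒lipschitz
  where
  constant⊎uniform⇒lipschitz : IsConstant (dill f) ⊎ IsUniform f → WeylLipschitz (dill f) (lipConst f)
  constant⊎uniform⇒lipschitz (inj₁ constant) = constant⇒lipschitz f constant
  constant⊎uniform⇒lipschitz (inj₂ uniform) = Uniform.uniform⇒lipschitz f uniform
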